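{- After the decomposition algorithm terminates, every refined segment $[b_c,j]\in\mathrm{RS}[c]$ satisfies: (i) it is a subinterval of some haplotype interval of $S_c$; and (ii) if $c'=\phi_j(c)>0$, it overlaps at most $d$ refined segments in $\mathrm{RS}[c']$.
   Context: Setting: haplotypes $S_1,\dots,S_h$ of length $m$; prefix array $\mathrm{PA}$ ($h\times m$, column $1$ is $1,\dots,h$, column $j>1$ sorts indices by co-lexicographic order of $S_i[1..j-1]$, ties broken stably); PBWT with $\mathrm{col}_j(\mathrm{PBWT})[x]=S_{\mathrm{col}_j(\mathrm{PA})[x]}[j]$; $(x,j)$ is a run-top if $x=1$ or $\mathrm{col}_j(\mathrm{PBWT})[x]\ne\mathrm{col}_j(\mathrm{PBWT})[x-1]$. For $\mathrm{col}_j(\mathrm{PA})[x]=i$: $\phi_j(i)=0$ if $x=1$, else $\phi_j(i)=\mathrm{col}_j(\mathrm{PA})[x-1]$. Haplotype intervals of $S_i$: with $b_1<\dots<b_k=m$ the set of $m$ and all columns $j$ such that some run-top $(x,j)$ has $\mathrm{col}_j(\mathrm{PA})[x]=i$, they are $[1,b_1],[b_1+1,b_2],\dots,[b_{k-1}+1,b_k]$. Two intervals overlap if they share an integer. Decomposition algorithm with integer parameter $d>1$: initially, for each $c$, $L_c$ is the linked list of haplotype intervals of $S_c$ in increasing order and $\mathrm{RS}[c]$ is empty. For $j=1,\dots,m$ and, within each $j$, for $i=1,\dots,h$: let $c=\mathrm{col}_j(\mathrm{PA})[i]$ and let $[b_c,e_c]$ be the first interval of $L_c$. If $j=e_c$,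 remove $[b_c,e_c]$ from $L_c$ and append it to the tail of $\mathrm{RS}[c]$ (Passive Split). Otherwise, if $i>1$ and $[b_c,j]$ overlaps exactly $d$ refined segments currently in $\mathrm{RS}[c']$, where $c'=\mathrm{col}_j(\mathrm{PA})[i-1]$, append $[b_c,j]$ to $\mathrm{RS}[c]$ and replace the head $[b_c,e_c]$ of $L_c$ by $[j+1,e_c]$ (Active Split). Intervals in the lists $\mathrm{RS}[\cdot]$ are called refined segments. -}

module Defs where

open import Data.Nat using (ℕ; zero; suc; _≤_; _<ᵇ_; _≡ᵇ_; _⊔_)
open import Data.Nat.Properties using (≤-trans; m≤m⊔n; m≤n⊔m; ⊔-lub; _≤?_)
open import Data.Fin using (Fin; toℕ; _≟_)
open import Data.Bool using (Bool; true; false; if_then_else_; not; _∧_; _∨_)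
open import Data.List using (List; []; _∷_; _++_; [_]; foldr; foldl; map; upTo; allFin; filter; length)
open import Data.Maybe using (Maybe; just; nothing)
open import Data.Product using (_×_; _,_; ∃; proj₁; proj₂)
open import Relation.Nullary using (Dec; yes; no; does; ¬_)

-- Haplotype indices are Fin h (0-based: Fin index k stands for S_{k+1});
-- positions are 1-based: S i j = S_i[j]; only positions 1..m are ever read.
Haplotypes : ℕ → Set
Haplotypes h = Fin h → ℕ → ℕ

Interval : Set
Interval = ℕ × ℕ   -- (b , e) stands for [b, e]

colexLt : (ℕ → ℕ) → (ℕ → ℕ) → ℕ → Bool
colexLt u v zero = false
colexLt u v (suc n) =
  if u (suc n) <ᵇ v (suc n) then true
  else if v (suc n) <ᵇ u (suc n) then false
  else colexLt u v n

-- order used in column j of PA: co-lex order of S_i[1..j-1], ties broken by index (stable)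
before : ∀ {h} → Haplotypes h → ℕ → Fin h → Fin h → Bool
before S j i i' =
  colexLt (S i) (S i') (j Data.Nat.∸ 1)
  ∨ (not (colexLt (S i') (S i) (j Data.Nat.∸ 1)) ∧ (toℕ i <ᵇ toℕ i'))

insertBy : ∀ {A : Set} → (A → A → Bool) → A → List A → List A
insertBy lt x [] = x ∷ []
insertBy lt x (y ∷ ys) = if lt x y then x ∷ y ∷ ys else y ∷ insertBy lt x ys

sortBy : ∀ {A : Set} → (A → A → Bool) → List A → List A
sortBy lt = foldr (insertBy lt) []

PAcol : ∀ {h} → Haplotypes h → ℕ → List (Fin h)
PAcol {h} S j = sortBy (before S j) (allFin h)

_==F_ : ∀ {h} → Fin h → Fin h → Bool
a ==F b = does (a ≟ b)

predIn : ∀ {h} → Fin h → List (Fin h) → Maybe (Fin h)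
predIn x (a ∷ b ∷ rest) = if x ==F b then just a else predIn x (b ∷ rest)
predIn x _ = nothing

-- φ_j(i): nothing encodes the value 0, just i' encodes haplotype i'
φ : ∀ {h} → Haplotypes h → ℕ → Fin h → Maybe (Fin h)
φ S j i = predIn i (PAcol S j)

-- is (x, j) a run-top, where col_j(PA)[x] = i ?
-- (x = 1, or col_j(PBWT)[x] ≠ col_j(PBWT)[x-1] = S_{col_j(PA)[x-1]}[j])
runTop : ∀ {h} → Haplotypes h → ℕ → Fin h → Bool
runTop S j i with φ S j i
... | nothing = true
... | just i' = not (S i' j ≡ᵇ S i j)

columns : ℕ → List ℕ
columns m = map suc (upTo m)

hapIntervals : ∀ {h} → ℕ → Haplotypes h → Fin h → List Interval
hapIntervals m S i = go 1 (columns m)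
  where
  go : ℕ → List ℕ → List Interval
  go s [] = []
  go s (j ∷ js) = if runTop S j i ∨ (j ≡ᵇ m) then (s , j) ∷ go (suc j) js else go s js

Overlap : Interval → Interval → Set
Overlap (b , e) (b' , e') = ∃ λ k → b ≤ k × k ≤ e × b' ≤ k × k ≤ e'

overlap? : ∀ I J → Dec (Overlap I J)
overlap? (b , e) (b' , e') with (b ⊔ b') ≤? e | (b ⊔ b') ≤? e'
... | yes p | yes q = yes (b ⊔ b' , m≤m⊔n b b' , p , m≤n⊔m b b' , q)
... | no ¬p | _ = no λ { (k , bk , ke , b'k , ke') → ¬p (≤-trans (⊔-lub bk b'k) ke) }
... | yes _ | no ¬q = no λ { (k , bk , ke , b'k , ke') → ¬q (≤-trans (⊔-lub bk b'k) ke') }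

countOverlaps : Interval → List Interval → ℕ
countOverlaps I rs = length (filter (overlap? I) rs)

Subinterval : Interval → Interval → Set
Subinterval (b , e) (B , E) = B ≤ b × e ≤ E

State : ℕ → Set
State h = (Fin h → List Interval) × (Fin h → List Interval)

update : ∀ {h} → (Fin h → List Interval) → Fin h → List Interval → Fin h → List Interval
update f c v c'' = if c'' ==F c then v else f c''

-- processing one row: d, column j, row's predecessor c' (nothing iff i = 1), c = col_j(PA)[i]
step : ∀ {h : ℕ} → ℕ → ℕ → State h → Maybe (Fin h) → Fin h → State h
step {h} d j (L , RS) prev c with L c
... | [] = (L , RS)
... | (b , e) ∷ rest =
  if j ≡ᵇ e
  then (update L c rest , update RS c (RS c ++ [ (b , e) ]))
  else active prev
  where
  active : Maybe (Fin h) → State h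
  active nothing = (L , RS)
  active (just c') =
    if countOverlaps (b , j) (RS c') ≡ᵇ d
    then (update L c ((suc j , e) ∷ rest) , update RS c (RS c ++ [ (b , j) ]))
    else (L , RS)

colPass : ∀ {h} → ℕ → ℕ → State h → Maybe (Fin h) → List (Fin h) → State h
colPass d j st prev [] = st
colPass d j st prev (c ∷ cs) = colPass d j (step d j st prev c) (just c) cs

initState : ∀ {h} → ℕ → Haplotypes h → State h
initState m S = (hapIntervals m S , λ _ → [])

runAlg : ∀ {h} → ℕ → ℕ → Haplotypes h → State h
runAlg m d S = foldl (λ st j → colPass d j st nothing (PAcol S j)) (initState m S) (columns m)

RSfinal : ∀ {h} → ℕ → ℕ → Haplotypes h → Fin h → List Interval
RSfinal m d S = proj₂ (runAlg m d S)

{-# OPTIONS --safe #-}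

-- Each haplotype's refined segments and pending intervals tile [1, m], and
-- segments are only ever cut from pending intervals, which are pieces of its
-- haplotype intervals: this is (i). For (ii), say c cuts [f, t] and p is its
-- predecessor in column t. A haplotype interval contains no run-top of c before
-- its end, so p was c's predecessor since column f as well; as c did not split
-- actively in column t - 1, fewer than d segments of p end in [f, t - 1]. At
-- most one more ends at t, and then p's next segment starts after t. Later on,
-- only that next segment of p can add to the overlaps with [f, t], so the
-- invariant maintained is "overlaps + [p's pending interval starts by t] ≤ d",
-- a potential that cutting segments never changes.

module Submission where

open import Defs
open import Data.Bool using (Bool; true; false; _∨_; T)
open import Data.Bool.Properties using (∨-conicalˡ; ∨-conicalʳ)
open import Data.Empty using (⊥-elim)
open import Data.Unit using (⊤; tt)
open import Data.List using (List; []; _∷_; _++_; [_]; _∷ʳ_; length; filter; foldl; last; allFin; applyUpTo)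
open import Data.List.Properties using (++-assoc; ++-identityʳ; map-upTo; length-++; filter-++; filter-accept; filter-reject; filter-none)
open import Data.List.Membership.Propositional using (_∈_; _∉_)
open import Data.List.Membership.Propositional.Properties using (∈-filter⁻; ∈-allFin; ∈-++⁺ˡ; ∈-++⁺ʳ; ∈-++⁻)
open import Data.List.Relation.Unary.Any using (here; there)
open import Data.List.Relation.Unary.All as All using (All; []; _∷_)
open import Data.List.Relation.Unary.All.Properties using (All¬⇒¬Any; ++⁺)
open import Data.List.Relation.Unary.AllPairs using (AllPairs; []; _∷_)
open import Data.List.Relation.Unary.Unique.Propositional using (Unique)
open import Data.List.Relation.Unary.Unique.Propositional.Properties using (allFin⁺)
open import Data.Maybe using (Maybe; just; nothing)
open import Data.Fin using (Fin; toℕ) renaming (_≟_ to _≟ᶠ_)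
open import Data.Fin.Properties using (toℕ-injective)
open import Data.Sum using (_⊎_; inj₁; inj₂; [_,_]′)
open import Data.Nat using (ℕ; zero; suc; _+_; _≤_; _<_; z≤n; s≤s; z<s; _<ᵇ_; _≡ᵇ_)
open import Data.Nat.Properties
open import Data.Product using (Σ; _×_; _,_; ∃; proj₁; proj₂; map₂; uncurry)
open import Function using (_∘_)
open import Relation.Nullary using (yes; no; ¬_; contradiction)
open import Relation.Nullary.Decidable using (_×-dec_)
open import Relation.Unary using (Decidable; _∩_; ∁)
open import Relation.Unary.Properties using (_∩?_; ∁?)
open import Relation.Binary.Definitions using (tri<; tri≈; tri>)
open import Relation.Binary.PropositionalEquality hiding ([_])

count : {A : Set} {P : A → Set} → Decidable P → List A → ℕ
count P? xs = length (filter P? xs)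

module _ {A : Set} {P : A → Set} (P? : Decidable P) where

  count-++ : ∀ xs ys → count P? (xs ++ ys) ≡ count P? xs + count P? ys
  count-++ xs ys = trans (cong length (filter-++ P? xs ys)) (length-++ (filter P? xs))

  count-∷ʳ-accept : ∀ xs {x} → P x → count P? (xs ∷ʳ x) ≡ suc (count P? xs)
  count-∷ʳ-accept xs px = begin
    count P? (xs ∷ʳ _)                ≡⟨ count-++ xs _ ⟩
    count P? xs + count P? [ _ ]      ≡⟨ cong (λ ys → count P? xs + length ys) (filter-accept P? px) ⟩
    count P? xs + 1                   ≡⟨ +-comm (count P? xs) 1 ⟩
    suc (count P? xs)                 ∎
    where open ≡-Reasoning

  count-∷ʳ-reject : ∀ xs {x} → ¬ P x → count P? (xs ∷ʳ x) ≡ count P? xs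
  count-∷ʳ-reject xs ¬px = begin
    count P? (xs ∷ʳ _)                ≡⟨ count-++ xs _ ⟩
    count P? xs + count P? [ _ ]      ≡⟨ cong (λ ys → count P? xs + length ys) (filter-reject P? ¬px) ⟩
    count P? xs + 0                   ≡⟨ +-identityʳ (count P? xs) ⟩
    count P? xs                       ∎
    where open ≡-Reasoning

  count-∷-accept : ∀ {x} xs → P x → count P? (x ∷ xs) ≡ suc (count P? xs)
  count-∷-accept xs px = cong length (filter-accept P? px)

  count-∷-reject : ∀ {x} xs → ¬ P x → count P? (x ∷ xs) ≡ count P? xs
  count-∷-reject xs ¬px = cong length (filter-reject P? ¬px)

  count-none : ∀ xs → (∀ {x} → x ∈ xs → ¬ P x) → count P? xs ≡ 0
  count-none xs none = cong length (filter-none P? (All.tabulate none))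

  count>0⇒∃ : ∀ xs → 0 < count P? xs → ∃ λ x → x ∈ xs × P x
  count>0⇒∃ xs pos with filter P? xs in eq
  ... | x ∷ _ = x , ∈-filter⁻ P? (subst (x ∈_) (sym eq) (here refl))

module _ {A : Set} {P Q : A → Set} (P? : Decidable P) (Q? : Decidable Q) where

  count-split : ∀ xs → count P? xs ≡ count (P? ∩? Q?) xs + count (P? ∩? ∁? Q?) xs
  count-split [] = refl
  count-split (x ∷ xs) with P? x | Q? x
  ... | yes _ | yes _ = cong suc (count-split xs)
  ... | yes _ | no _  = trans (cong suc (count-split xs)) (sym (+-suc _ _))
  ... | no _  | _     = count-split xs

  count-cong : ∀ xs → (∀ {x} → x ∈ xs → P x → Q x) → (∀ {x} → x ∈ xs → Q x → P x) →
               count P? xs ≡ count Q? xs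
  count-cong [] _ _ = refl
  count-cong (x ∷ xs) to from with P? x | Q? x
  ... | yes _ | yes _ = cong suc (count-cong xs (to ∘ there) (from ∘ there))
  ... | no _  | no _  = count-cong xs (to ∘ there) (from ∘ there)
  ... | yes p | no ¬q = ⊥-elim (¬q (to (here refl) p))
  ... | no ¬p | yes q = ⊥-elim (¬p (from (here refl) q))

-- Chain a b R: the nonempty intervals of R tile [a, b - 1] from left to right.
data Chain : ℕ → ℕ → List Interval → Set where
  []  : ∀ {a} → Chain a a []
  _∷_ : ∀ {a e b R} → a ≤ e → Chain (suc e) b R → Chain a b ((a , e) ∷ R)

Chain-≤ : ∀ {a b R} → Chain a b R → a ≤ b
Chain-≤ [] = ≤-refl
Chain-≤ (a≤e ∷ ch) = ≤-trans (m≤n⇒m≤1+n a≤e) (Chain-≤ ch)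

Chain-∈ : ∀ {a b R x y} → Chain a b R → (x , y) ∈ R → a ≤ x × x ≤ y × y < b
Chain-∈ (a≤e ∷ ch) (here refl) = ≤-refl , a≤e , Chain-≤ ch
Chain-∈ (a≤e ∷ ch) (there mem) with Chain-∈ ch mem
... | e<x , x≤y , y<b = ≤-trans (m≤n⇒m≤1+n a≤e) e<x , x≤y , y<b

Chain-head : ∀ {a b f e R} → Chain a b ((f , e) ∷ R) → f ≡ a
Chain-head (_ ∷ _) = refl

Chain-∷ʳ : ∀ {a b R e} → Chain a b R → b ≤ e → Chain a (suc e) (R ∷ʳ (b , e))
Chain-∷ʳ [] b≤e = b≤e ∷ []
Chain-∷ʳ (a≤e ∷ ch) b≤e = a≤e ∷ Chain-∷ʳ ch b≤e

EndsIn : ℕ → ℕ → Interval → Set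
EndsIn f k (_ , y) = f ≤ y × y ≤ k

endsIn? : ∀ f k → Decidable (EndsIn f k)
endsIn? f k (_ , y) = f ≤? y ×-dec y ≤? k

countEnds : ℕ → ℕ → List Interval → ℕ
countEnds f k = count (endsIn? f k)

countEnds-Chain-≤1 : ∀ {a b R} t → Chain a b R → countEnds t t R ≤ 1
countEnds-Chain-≤1 t [] = z≤n
countEnds-Chain-≤1 t (_∷_ {a} {e} {_} {R} _ ch) with endsIn? t t (a , e)
... | no ¬p = ≤-trans (≤-reflexive (count-∷-reject (endsIn? t t) R ¬p)) (countEnds-Chain-≤1 t ch)
... | yes p@(t≤e , _) = ≤-reflexive (trans (count-∷-accept (endsIn? t t) R p)
                                            (cong suc (count-none (endsIn? t t) R later)))
  where
  later : ∀ {x} → x ∈ R → ¬ EndsIn t t x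
  later mem (_ , y≤t) with Chain-∈ ch mem
  ... | e<x , x≤y , _ = <⇒≱ (≤-trans (s≤s t≤e) (≤-trans e<x x≤y)) y≤t

countEnds-split : ∀ {f k} R → f ≤ suc k →
                  countEnds f (suc k) R ≡ countEnds f k R + countEnds (suc k) (suc k) R
countEnds-split {f} {k} R f≤1+k = begin
  countEnds f (suc k) R
    ≡⟨ count-split (endsIn? f (suc k)) endsBy? R ⟩
  count (endsIn? f (suc k) ∩? endsBy?) R + count (endsIn? f (suc k) ∩? ∁? endsBy?) R
    ≡⟨ cong₂ _+_ (count-cong (endsIn? f (suc k) ∩? endsBy?) (endsIn? f k) R
                             (λ {x} _ → earlier⁻ {x}) (λ {x} _ → earlier⁺ {x}))
                 (count-cong (endsIn? f (suc k) ∩? ∁? endsBy?) (endsIn? (suc k) (suc k)) R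
                             (λ {x} _ → exact⁻ {x}) (λ {x} _ → exact⁺ {x})) ⟩
  countEnds f k R + countEnds (suc k) (suc k) R ∎
  where
  open ≡-Reasoning
  EndsBy : Interval → Set
  EndsBy (_ , y) = y ≤ k
  endsBy? : Decidable EndsBy
  endsBy? (_ , y) = y ≤? k
  earlier⁻ : ∀ {x} → (EndsIn f (suc k) ∩ EndsBy) x → EndsIn f k x
  earlier⁻ ((f≤y , _) , y≤k) = f≤y , y≤k
  earlier⁺ : ∀ {x} → EndsIn f k x → (EndsIn f (suc k) ∩ EndsBy) x
  earlier⁺ (f≤y , y≤k) = (f≤y , m≤n⇒m≤1+n y≤k) , y≤k
  exact⁻ : ∀ {x} → (EndsIn f (suc k) ∩ ∁ EndsBy) x → EndsIn (suc k) (suc k) x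
  exact⁻ ((_ , y≤1+k) , y≰k) = ≰⇒> y≰k , y≤1+k
  exact⁺ : ∀ {x} → EndsIn (suc k) (suc k) x → (EndsIn f (suc k) ∩ ∁ EndsBy) x
  exact⁺ (k<y , y≤1+k) = (≤-trans f≤1+k k<y , y≤1+k) , <⇒≱ k<y

countOverlaps≡countEnds : ∀ {f t} R → (∀ {x y} → (x , y) ∈ R → x ≤ y × y ≤ t) →
                          countOverlaps (f , t) R ≡ countEnds f t R
countOverlaps≡countEnds {f} {t} R bounded = count-cong (overlap? (f , t)) (endsIn? f t) R to from
  where
  to : ∀ {x} → x ∈ R → Overlap (f , t) x → EndsIn f t x
  to mem (_ , f≤q , _ , _ , q≤y) = ≤-trans f≤q q≤y , proj₂ (bounded mem)
  from : ∀ {x} → x ∈ R → EndsIn f t x → Overlap (f , t) x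
  from {_ , y} mem (f≤y , y≤t) = y , f≤y , y≤t , proj₁ (bounded mem) , ≤-refl

headStartsBy : ℕ → List Interval → ℕ
headStartsBy j [] = 0
headStartsBy j ((s , _) ∷ _) with s ≤? j
... | yes _ = 1
... | no _  = 0

headStartsBy-≤1 : ∀ j L → headStartsBy j L ≤ 1
headStartsBy-≤1 j [] = z≤n
headStartsBy-≤1 j ((s , _) ∷ _) with s ≤? j
... | yes _ = ≤-refl
... | no _  = z≤n

headStartsBy-Chain : ∀ {j a b L} → Chain a b L → j < a → headStartsBy j L ≡ 0
headStartsBy-Chain [] _ = refl
headStartsBy-Chain {j} {a} (_ ∷ _) j<a with a ≤? j
... | yes a≤j = ⊥-elim (<⇒≱ j<a a≤j)
... | no _    = refl

countOverlaps-cut : ∀ {b j t} R f e rest → b ≤ j → j ≤ t →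
  countOverlaps (b , j) (R ∷ʳ (f , t)) ≡ countOverlaps (b , j) R + headStartsBy j ((f , e) ∷ rest)
countOverlaps-cut {b} {j} {t} R f e rest b≤j j≤t with f ≤? j
... | yes f≤j = trans (count-∷ʳ-accept (overlap? (b , j)) R (j , b≤j , ≤-refl , f≤j , j≤t)) (+-comm 1 _)
... | no f≰j  = trans (count-∷ʳ-reject (overlap? (b , j)) R
                             λ (_ , _ , q≤j , f≤q , _) → f≰j (≤-trans f≤q q≤j))
                      (sym (+-identityʳ _))

Sorted : {A : Set} → (A → A → Bool) → List A → Set
Sorted _≺_ = AllPairs (λ x y → T (x ≺ y))

module StrictOrder {A : Set} (_≺_ : A → A → Bool)
  (≺-irrefl : ∀ x → ¬ T (x ≺ x))
  (≺-trans : ∀ {x y z} → T (x ≺ y) → T (y ≺ z) → T (x ≺ z)) where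

  Sorted⇒Unique : ∀ {xs} → Sorted _≺_ xs → Unique xs
  Sorted⇒Unique [] = []
  Sorted⇒Unique (x≺xs ∷ sorted) =
    All.map (λ { x≺y refl → ≺-irrefl _ x≺y }) x≺xs ∷ Sorted⇒Unique sorted

  module InsertionSort (≺-total : ∀ {x y} → x ≢ y → ¬ T (x ≺ y) → T (y ≺ x)) where

    insertBy-∈⁻ : ∀ {z} x ys → z ∈ insertBy _≺_ x ys → z ≡ x ⊎ z ∈ ys
    insertBy-∈⁻ x [] (here refl) = inj₁ refl
    insertBy-∈⁻ x (y ∷ ys) mem with x ≺ y
    insertBy-∈⁻ x (y ∷ ys) (here refl) | true  = inj₁ refl
    insertBy-∈⁻ x (y ∷ ys) (there mem) | true  = inj₂ mem
    insertBy-∈⁻ x (y ∷ ys) (here refl) | false = inj₂ (here refl)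
    insertBy-∈⁻ x (y ∷ ys) (there mem) | false with insertBy-∈⁻ x ys mem
    ... | inj₁ z≡x = inj₁ z≡x
    ... | inj₂ z∈ys = inj₂ (there z∈ys)

    insertBy-∈⁺ : ∀ {z} x ys → z ≡ x ⊎ z ∈ ys → z ∈ insertBy _≺_ x ys
    insertBy-∈⁺ x [] (inj₁ refl) = here refl
    insertBy-∈⁺ x (y ∷ ys) z∈ with x ≺ y
    insertBy-∈⁺ x (y ∷ ys) (inj₁ refl)         | true  = here refl
    insertBy-∈⁺ x (y ∷ ys) (inj₂ mem)          | true  = there mem
    insertBy-∈⁺ x (y ∷ ys) (inj₁ refl)         | false = there (insertBy-∈⁺ x ys (inj₁ refl))
    insertBy-∈⁺ x (y ∷ ys) (inj₂ (here refl))  | false = here refl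
    insertBy-∈⁺ x (y ∷ ys) (inj₂ (there mem))  | false = there (insertBy-∈⁺ x ys (inj₂ mem))

    insertBy-sorted : ∀ x ys → x ∉ ys → Sorted _≺_ ys → Sorted _≺_ (insertBy _≺_ x ys)
    insertBy-sorted x [] _ _ = [] ∷ []
    insertBy-sorted x (y ∷ ys) x∉ (y≺ys ∷ sorted) with x ≺ y in x≺y
    ... | true  = (subst T (sym x≺y) tt ∷ All.map (≺-trans (subst T (sym x≺y) tt)) y≺ys) ∷ y≺ys ∷ sorted
    ... | false = All.tabulate y≺ ∷ insertBy-sorted x ys (x∉ ∘ there) sorted
      where
      y≺ : ∀ {z} → z ∈ insertBy _≺_ x ys → T (y ≺ z)
      y≺ mem with insertBy-∈⁻ x ys mem
      ... | inj₁ refl = ≺-total (λ { refl → x∉ (here refl) }) (subst T x≺y)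
      ... | inj₂ z∈ys = All.lookup y≺ys z∈ys

    sortBy-∈⁻ : ∀ {z} xs → z ∈ sortBy _≺_ xs → z ∈ xs
    sortBy-∈⁻ (x ∷ xs) mem with insertBy-∈⁻ x (sortBy _≺_ xs) mem
    ... | inj₁ refl = here refl
    ... | inj₂ mem′ = there (sortBy-∈⁻ xs mem′)

    sortBy-∈⁺ : ∀ {z} xs → z ∈ xs → z ∈ sortBy _≺_ xs
    sortBy-∈⁺ (x ∷ xs) (here refl) = insertBy-∈⁺ x (sortBy _≺_ xs) (inj₁ refl)
    sortBy-∈⁺ (x ∷ xs) (there mem) = insertBy-∈⁺ x (sortBy _≺_ xs) (inj₂ (sortBy-∈⁺ xs mem))

    sortBy-sorted : ∀ xs → Unique xs → Sorted _≺_ (sortBy _≺_ xs)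
    sortBy-sorted [] _ = []
    sortBy-sorted (x ∷ xs) (x∉xs ∷ unique) =
      insertBy-sorted x (sortBy _≺_ xs) (All¬⇒¬Any x∉xs ∘ sortBy-∈⁻ xs) (sortBy-sorted xs unique)

last-∈ : ∀ {A : Set} (xs : List A) {p} → last xs ≡ just p → p ∈ xs
last-∈ (x ∷ []) refl = here refl
last-∈ (x ∷ y ∷ xs) eq = there (last-∈ (y ∷ xs) eq)

last-∷ʳ : ∀ {A : Set} (xs : List A) x → last (xs ∷ʳ x) ≡ just x
last-∷ʳ [] x = refl
last-∷ʳ (y ∷ []) x = refl
last-∷ʳ (y ∷ z ∷ xs) x = last-∷ʳ (z ∷ xs) x

module _ {h : ℕ} where

  predIn-∈ : ∀ (c a : Fin h) L {p} → predIn c (a ∷ L) ≡ just p → p ∈ a ∷ L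
  predIn-∈ c a (b ∷ L) eq with c ≟ᶠ b
  predIn-∈ c a (b ∷ L) refl | yes _ = here refl
  ... | no _ = there (predIn-∈ c b L eq)

  predIn-∃ : ∀ (c a : Fin h) L → c ∈ L → ∃ λ p → predIn c (a ∷ L) ≡ just p
  predIn-∃ c a (b ∷ L) c∈ with c ≟ᶠ b | c∈
  ... | yes _   | _          = a , refl
  ... | no c≢b  | here c≡b   = ⊥-elim (c≢b c≡b)
  ... | no _    | there c∈L  = predIn-∃ c b L c∈L

  predIn-∉ : ∀ (c a : Fin h) L → c ∉ L → predIn c (a ∷ L) ≡ nothing
  predIn-∉ c a [] _ = refl
  predIn-∉ c a (b ∷ L) c∉ with c ≟ᶠ b
  ... | yes c≡b = ⊥-elim (c∉ (here c≡b))
  ... | no _    = predIn-∉ c b L (c∉ ∘ there)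

  predIn-++-∷ : ∀ (c : Fin h) xs ys → c ∉ xs → c ∉ ys → predIn c (xs ++ c ∷ ys) ≡ last xs
  predIn-++-∷ c [] ys _ c∉ys = predIn-∉ c c ys c∉ys
  predIn-++-∷ c (a ∷ xs) ys c∉ _ = go a xs (c∉ ∘ there)
    where
    go : ∀ a xs → c ∉ xs → predIn c (a ∷ xs ++ c ∷ ys) ≡ last (a ∷ xs)
    go a [] _ with c ≟ᶠ c
    ... | yes _   = refl
    ... | no c≢c  = ⊥-elim (c≢c refl)
    go a (b ∷ xs) c∉ with c ≟ᶠ b
    ... | yes c≡b = ⊥-elim (c∉ (here c≡b))
    ... | no _    = go b xs (c∉ ∘ there)

module SortedPredecessor {h : ℕ} (_≺_ : Fin h → Fin h → Bool)
  (≺-irrefl : ∀ x → ¬ T (x ≺ x))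
  (≺-trans : ∀ {x y z} → T (x ≺ y) → T (y ≺ z) → T (x ≺ z)) where

  IsPredecessor : List (Fin h) → Fin h → Fin h → Set
  IsPredecessor L p c = T (p ≺ c) × (∀ {z} → z ∈ L → T (z ≺ c) → z ≡ p ⊎ T (z ≺ p))

  predIn-sorted⇒ : ∀ {L c p} → Sorted _≺_ L → predIn c L ≡ just p → IsPredecessor L p c
  predIn-sorted⇒ {a ∷ L} = go a L
    where
    go : ∀ a L {c p} → Sorted _≺_ (a ∷ L) → predIn c (a ∷ L) ≡ just p → IsPredecessor (a ∷ L) p c
    go a (b ∷ L) {c} (a≺ ∷ sorted@(b≺ ∷ _)) eq with c ≟ᶠ b
    go a (b ∷ L) (a≺ ∷ (b≺ ∷ _)) refl | yes refl = All.lookup a≺ (here refl) , below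
      where
      below : ∀ {z} → z ∈ a ∷ b ∷ L → T (z ≺ b) → z ≡ a ⊎ T (z ≺ a)
      below (here refl) _ = inj₁ refl
      below (there (here refl)) z≺b = ⊥-elim (≺-irrefl b z≺b)
      below (there (there z∈L)) z≺b = ⊥-elim (≺-irrefl b (≺-trans (All.lookup b≺ z∈L) z≺b))
    ... | no _ with go b L sorted eq
    ...   | p≺c , below = p≺c , λ { (here refl) _ → inj₂ (All.lookup a≺ (predIn-∈ c b L eq))
                                  ; (there z∈) z≺c → below z∈ z≺c }

  IsPredecessor-unique : ∀ {L c p p′} → p ∈ L → p′ ∈ L →
                         IsPredecessor L p c → IsPredecessor L p′ c → p ≡ p′
  IsPredecessor-unique p∈ p′∈ (p≺c , below) (p′≺c , below′) with below′ p∈ p≺c | below p′∈ p′≺c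
  ... | inj₁ p≡p′ | _ = p≡p′
  ... | inj₂ _ | inj₁ p′≡p = sym p′≡p
  ... | inj₂ p≺p′ | inj₂ p′≺p = ⊥-elim (≺-irrefl _ (≺-trans p≺p′ p′≺p))

  sorted-∈-tail : ∀ {a L c p} → Sorted _≺_ (a ∷ L) → c ∈ a ∷ L → p ∈ a ∷ L → T (p ≺ c) → c ∈ L
  sorted-∈-tail _ (here refl) (here refl) p≺c = ⊥-elim (≺-irrefl _ p≺c)
  sorted-∈-tail (a≺ ∷ _) (here refl) (there p∈) p≺c =
    ⊥-elim (≺-irrefl _ (≺-trans (All.lookup a≺ p∈) p≺c))
  sorted-∈-tail _ (there c∈) _ _ = c∈

  predIn-sorted⇐ : ∀ {L c p} → Sorted _≺_ L → c ∈ L → p ∈ L → IsPredecessor L p c → predIn c L ≡ just p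
  predIn-sorted⇐ {a ∷ L} {c} sorted c∈ p∈ isPred
    with predIn-∃ c a L (sorted-∈-tail sorted c∈ p∈ (proj₁ isPred))
  ... | p′ , eq = trans eq (cong just (IsPredecessor-unique (predIn-∈ c a L eq) p∈
                                        (predIn-sorted⇒ sorted eq) isPred))

≡ᵇ≡true⇒≡ : ∀ {m n} → (m ≡ᵇ n) ≡ true → m ≡ n
≡ᵇ≡true⇒≡ {m} {n} m≡ᵇn = ≡ᵇ⇒≡ m n (subst T (sym m≡ᵇn) tt)

≡ᵇ≡false⇒≢ : ∀ {m n} → (m ≡ᵇ n) ≡ false → m ≢ n
≡ᵇ≡false⇒≢ {m} {n} m≢ᵇn m≡n = subst T m≢ᵇn (≡⇒≡ᵇ m n m≡n)

module Columns {h : ℕ} (S : Haplotypes h) where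

  -- x ≺[ k ] y: x precedes y in column k + 1 of PA, which sorts by S[1..k].
  _≺[_]_ : Fin h → ℕ → Fin h → Set
  x ≺[ k ] y = T (before S (suc k) x y)

  ≺[0]⇒< : ∀ x y → x ≺[ 0 ] y → toℕ x < toℕ y
  ≺[0]⇒< x y = <ᵇ⇒< (toℕ x) (toℕ y)

  <⇒≺[0] : ∀ x y → toℕ x < toℕ y → x ≺[ 0 ] y
  <⇒≺[0] x y = <⇒<ᵇ

  ≺[suc]⁻ : ∀ k {x y} → x ≺[ suc k ] y →
            S x (suc k) < S y (suc k) ⊎ (S x (suc k) ≡ S y (suc k) × x ≺[ k ] y)
  ≺[suc]⁻ k {x} {y} x≺y with S x (suc k) <ᵇ S y (suc k) in xy | S y (suc k) <ᵇ S x (suc k) in yx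
  ... | true  | _     = inj₁ (<ᵇ⇒< _ _ (subst T (sym xy) tt))
  ... | false | false =
    inj₂ (≤-antisym (≮⇒≥ (subst T yx ∘ <⇒<ᵇ)) (≮⇒≥ (subst T xy ∘ <⇒<ᵇ)) , x≺y)

  ≺[suc]⁺ˡ : ∀ k {x y} → S x (suc k) < S y (suc k) → x ≺[ suc k ] y
  ≺[suc]⁺ˡ k {x} {y} x<y with S x (suc k) <ᵇ S y (suc k) in xy
  ... | true  = tt
  ... | false = ⊥-elim (subst T xy (<⇒<ᵇ x<y))

  ≺[suc]⁺ʳ : ∀ k {x y} → S x (suc k) ≡ S y (suc k) → x ≺[ k ] y → x ≺[ suc k ] y
  ≺[suc]⁺ʳ k {x} {y} x≡y x≺y with S x (suc k) <ᵇ S y (suc k) | S y (suc k) <ᵇ S x (suc k) in yx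
  ... | true  | _     = tt
  ... | false | true  = ⊥-elim (<-irrefl (sym x≡y) (<ᵇ⇒< _ _ (subst T (sym yx) tt)))
  ... | false | false = x≺y

  ≺-irrefl : ∀ k x → ¬ x ≺[ k ] x
  ≺-irrefl zero x x≺x = <-irrefl refl (≺[0]⇒< x x x≺x)
  ≺-irrefl (suc k) x x≺x with ≺[suc]⁻ k x≺x
  ... | inj₁ x<x = <-irrefl refl x<x
  ... | inj₂ (_ , x≺x′) = ≺-irrefl k x x≺x′

  ≺-trans : ∀ k {x y z} → x ≺[ k ] y → y ≺[ k ] z → x ≺[ k ] z
  ≺-trans zero {x} {y} {z} x≺y y≺z = <⇒≺[0] x z (<-trans (≺[0]⇒< x y x≺y) (≺[0]⇒< y z y≺z))
  ≺-trans (suc k) x≺y y≺z with ≺[suc]⁻ k x≺y | ≺[suc]⁻ k y≺z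
  ... | inj₁ x<y        | inj₁ y<z        = ≺[suc]⁺ˡ k (<-trans x<y y<z)
  ... | inj₁ x<y        | inj₂ (y≡z , _)  = ≺[suc]⁺ˡ k (≤-trans x<y (≤-reflexive y≡z))
  ... | inj₂ (x≡y , _)  | inj₁ y<z        = ≺[suc]⁺ˡ k (≤-trans (s≤s (≤-reflexive x≡y)) y<z)
  ... | inj₂ (x≡y , x≺y′) | inj₂ (y≡z , y≺z′) = ≺[suc]⁺ʳ k (trans x≡y y≡z) (≺-trans k x≺y′ y≺z′)

  ≺-total : ∀ k {x y} → x ≢ y → ¬ x ≺[ k ] y → y ≺[ k ] x
  ≺-total zero {x} {y} x≢y x⊀y with <-cmp (toℕ x) (toℕ y)
  ... | tri< x<y _ _ = ⊥-elim (x⊀y (<⇒≺[0] x y x<y))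
  ... | tri≈ _ x≡y _ = ⊥-elim (x≢y (toℕ-injective x≡y))
  ... | tri> _ _ y<x = <⇒≺[0] y x y<x
  ≺-total (suc k) {x} {y} x≢y x⊀y with <-cmp (S x (suc k)) (S y (suc k))
  ... | tri< x<y _ _ = ⊥-elim (x⊀y (≺[suc]⁺ˡ k x<y))
  ... | tri≈ _ x≡y _ = ≺[suc]⁺ʳ k (sym x≡y) (≺-total k x≢y (x⊀y ∘ ≺[suc]⁺ʳ k x≡y))
  ... | tri> _ _ y<x = ≺[suc]⁺ˡ k y<x

  PA : ℕ → List (Fin h)
  PA k = PAcol S (suc k)

  private
    module Order (k : ℕ) = StrictOrder (before S (suc k)) (≺-irrefl k) (≺-trans k)
    module Sort (k : ℕ) = Order.InsertionSort k (≺-total k)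
    module Pred (k : ℕ) = SortedPredecessor (before S (suc k)) (≺-irrefl k) (≺-trans k)

  PA-sorted : ∀ k → Sorted (before S (suc k)) (PA k)
  PA-sorted k = Sort.sortBy-sorted k (allFin h) (allFin⁺ h)

  PA-unique : ∀ k → Unique (PA k)
  PA-unique k = Order.Sorted⇒Unique k (PA-sorted k)

  PA-complete : ∀ k x → x ∈ PA k
  PA-complete k x = Sort.sortBy-∈⁺ k (allFin h) (∈-allFin x)

  -- No row can sort strictly between c and its predecessor p once both are
  -- extended by the same symbol.
  φ-persists : ∀ k {c p} → φ S (suc k) c ≡ just p → S p (suc k) ≡ S c (suc k) →
               φ S (suc (suc k)) c ≡ just p
  φ-persists k {c} {p} φc same with Pred.predIn-sorted⇒ k (PA-sorted k) φc
  ... | p≺c , below = Pred.predIn-sorted⇐ (suc k) (PA-sorted (suc k))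
                        (PA-complete (suc k) c) (PA-complete (suc k) p) (≺[suc]⁺ʳ k same p≺c , below′)
    where
    below′ : ∀ {z} → z ∈ PA (suc k) → z ≺[ suc k ] c → z ≡ p ⊎ z ≺[ suc k ] p
    below′ _ z≺c with ≺[suc]⁻ k z≺c
    ... | inj₁ z<c = inj₂ (≺[suc]⁺ˡ k (≤-trans z<c (≤-reflexive (sym same))))
    ... | inj₂ (z≡c , z≺c′) with below (PA-complete k _) z≺c′
    ...   | inj₁ z≡p = inj₁ z≡p
    ...   | inj₂ z≺p = inj₂ (≺[suc]⁺ʳ k (trans z≡c (sym same)) z≺p)

  ¬runTop⇒φ : ∀ j c → runTop S j c ≡ false → ∃ λ p → φ S j c ≡ just p × S p j ≡ S c j
  ¬runTop⇒φ j c ¬top with φ S j c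
  ... | just p with S p j ≡ᵇ S c j in same
  ...   | true = p , refl , ≡ᵇ≡true⇒≡ same

  φ-¬runTop : ∀ k {c p} → runTop S (suc k) c ≡ false →
              φ S (suc (suc k)) c ≡ just p → φ S (suc k) c ≡ just p
  φ-¬runTop k {c} ¬top φc′ with ¬runTop⇒φ (suc k) c ¬top
  ... | p , φc , same with trans (sym (φ-persists k φc same)) φc′
  ...   | refl = φc

range : ℕ → ℕ → List ℕ
range k zero = []
range k (suc n) = k ∷ range (suc k) n

applyUpTo≡range : ∀ (f : ℕ → ℕ) k n → (∀ i → f i ≡ k + i) → applyUpTo f n ≡ range k n
applyUpTo≡range f k zero _ = refl
applyUpTo≡range f k (suc n) f≗k+ =
  cong₂ _∷_ (trans (f≗k+ 0) (+-identityʳ k))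
            (applyUpTo≡range (f ∘ suc) (suc k) n (λ i → trans (f≗k+ (suc i)) (+-suc k i)))

columns≡range : ∀ m → columns m ≡ range 1 m
columns≡range m = trans (map-upTo suc m) (applyUpTo≡range suc 1 m (λ _ → refl))

module HaplotypeIntervals {h : ℕ} (m : ℕ) (S : Haplotypes h) (c : Fin h) where

  -- Defs defines hapIntervals through a local function that cannot be named
  -- here; abstracting its arguments lets unification solve for it.
  private
    unfolded : Σ (ℕ → List ℕ → List Interval) λ go → go 1 (columns m) ≡ hapIntervals m S c
    unfolded = go , go-columns
      where
      go : ℕ → List ℕ → List Interval
      go = _
      go-columns : go 1 (columns m) ≡ hapIntervals m S c
      go-columns with 1 | columns m
      ... | _ | _ = refl

  hapIntervalsFrom : ℕ → List ℕ → List Interval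
  hapIntervalsFrom = proj₁ unfolded

  hapIntervalsFrom-Chain : ∀ n {s k} → s ≤ k → k + n ≡ suc m → (n ≡ 0 → s ≡ k) →
                           Chain s (suc m) (hapIntervalsFrom s (range k n))
  hapIntervalsFrom-Chain zero {s} {k} _ k+0≡1+m s≡k =
    subst (λ b → Chain s b []) (trans (s≡k refl) (trans (sym (+-identityʳ k)) k+0≡1+m)) []
  hapIntervalsFrom-Chain (suc n) {s} {k} s≤k k+n≡1+m s≡k with runTop S k c ∨ (k ≡ᵇ m) in breaks
  ... | true  = s≤k ∷ hapIntervalsFrom-Chain n ≤-refl (trans (sym (+-suc k n)) k+n≡1+m) (λ _ → refl)
  ... | false = hapIntervalsFrom-Chain n (m≤n⇒m≤1+n s≤k) (trans (sym (+-suc k n)) k+n≡1+m) last-breaks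
    where
    last-breaks : n ≡ 0 → s ≡ suc k
    last-breaks refl = ⊥-elim (≡ᵇ≡false⇒≢ (∨-conicalʳ (runTop S k c) _ breaks)
                                           (suc-injective (trans (+-comm 1 k) k+n≡1+m)))

  hapIntervalsFrom-¬runTop : ∀ n {s k} → (∀ {u} → s ≤ u → u < k → runTop S u c ≡ false) →
    ∀ {B e} → (B , e) ∈ hapIntervalsFrom s (range k n) → ∀ {u} → B ≤ u → u < e → runTop S u c ≡ false
  hapIntervalsFrom-¬runTop (suc n) {s} {k} ¬top mem with runTop S k c ∨ (k ≡ᵇ m) in breaks | mem
  ... | true  | here refl = ¬top
  ... | true  | there mem′ = hapIntervalsFrom-¬runTop n (λ k<u u<k → ⊥-elim (<⇒≱ u<k k<u)) mem′
  ... | false | mem′ = hapIntervalsFrom-¬runTop n ¬top′ mem′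
    where
    ¬top′ : ∀ {u} → s ≤ u → u < suc k → runTop S u c ≡ false
    ¬top′ {u} s≤u u<1+k with u ≟ k
    ... | yes refl = ∨-conicalˡ (runTop S k c) _ breaks
    ... | no u≢k  = ¬top s≤u (≤∧≢⇒< (≤-pred u<1+k) u≢k)

  hapIntervals-Chain : Chain 1 (suc m) (hapIntervals m S c)
  hapIntervals-Chain = subst (λ cols → Chain 1 (suc m) (hapIntervalsFrom 1 cols)) (sym (columns≡range m))
                         (hapIntervalsFrom-Chain m ≤-refl refl (λ _ → refl))

  hapIntervals-¬runTop : ∀ {B e} → (B , e) ∈ hapIntervals m S c →
                         ∀ {u} → B ≤ u → u < e → runTop S u c ≡ false
  hapIntervals-¬runTop mem = hapIntervalsFrom-¬runTop m (λ 1≤u u<1 → ⊥-elim (<⇒≱ u<1 1≤u))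
                               (subst (λ cols → _ ∈ hapIntervalsFrom 1 cols) (columns≡range m) mem)

module _ {h : ℕ} where

  update-≡ : ∀ (f : Fin h → List Interval) c v → update f c v c ≡ v
  update-≡ f c v with c ≟ᶠ c
  ... | yes _   = refl
  ... | no c≢c  = ⊥-elim (c≢c refl)

  update-≢ : ∀ (f : Fin h → List Interval) c v {c′} → c′ ≢ c → update f c v c′ ≡ f c′
  update-≢ f c v {c′} c′≢c with c′ ≟ᶠ c
  ... | yes c′≡c = ⊥-elim (c′≢c c′≡c)
  ... | no _     = refl

  data StepView (d t : ℕ) (L RS : Fin h → List Interval) (prev : Maybe (Fin h)) (c : Fin h) :
                State h → Set where
    passive  : ∀ {f rest} → L c ≡ (f , t) ∷ rest →
               StepView d t L RS prev c (update L c rest , update RS c (RS c ∷ʳ (f , t)))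
    active   : ∀ {f e rest} → L c ≡ (f , e) ∷ rest → t ≢ e →
               StepView d t L RS prev c (update L c ((suc t , e) ∷ rest) , update RS c (RS c ∷ʳ (f , t)))
    extend   : ∀ {f e rest} → L c ≡ (f , e) ∷ rest → t ≢ e →
               (∀ {c′} → prev ≡ just c′ → countOverlaps (f , t) (RS c′) ≢ d) →
               StepView d t L RS prev c (L , RS)
    finished : L c ≡ [] → StepView d t L RS prev c (L , RS)

  step-view : ∀ d t L RS prev c → StepView d t L RS prev c (step d t (L , RS) prev c)
  step-view d t L RS prev c with L c in eqL
  ... | [] = finished eqL
  ... | (f , e) ∷ rest with t ≡ᵇ e in t≡ᵇe
  ...   | true with ≡ᵇ≡true⇒≡ {t} {e} t≡ᵇe
  ...     | refl = passive eqL
  step-view d t L RS nothing c | (f , e) ∷ rest | false = extend eqL (≡ᵇ≡false⇒≢ t≡ᵇe) λ ()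
  step-view d t L RS (just c′) c | (f , e) ∷ rest | false with countOverlaps (f , t) (RS c′) ≡ᵇ d in cnt≡ᵇd
  ... | true  = active eqL (≡ᵇ≡false⇒≢ t≡ᵇe)
  ... | false = extend eqL (≡ᵇ≡false⇒≢ t≡ᵇe) λ { refl → ≡ᵇ≡false⇒≢ cnt≡ᵇd }

Unique-++-∷ : ∀ {A : Set} (xs : List A) {c ys} → Unique (xs ++ c ∷ ys) → c ∉ xs × c ∉ ys
Unique-++-∷ [] (c∉ys ∷ _) = (λ ()) , All¬⇒¬Any c∉ys
Unique-++-∷ (a ∷ xs) (a∉ ∷ unique) with Unique-++-∷ xs unique
... | c∉xs , c∉ys = c∉a∷xs , c∉ys
  where
  c∉a∷xs : _ ∉ a ∷ xs
  c∉a∷xs (here refl) = All¬⇒¬Any a∉ (∈-++⁺ʳ xs (here refl))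
  c∉a∷xs (there c∈xs) = c∉xs c∈xs

module Decomposition {h : ℕ} (m d : ℕ) (0<d : 0 < d) (S : Haplotypes h) where

  open Columns S

  hap : Fin h → List Interval
  hap = hapIntervals m S

  WithinHap : Fin h → Interval → Set
  WithinHap x I = ∃ λ J → J ∈ hap x × Subinterval I J

  HeadEnd≥ : ℕ → List Interval → Set
  HeadEnd≥ t [] = ⊤
  HeadEnd≥ t ((_ , e) ∷ _) = t ≤ e

  Chain-head-end : ∀ {a b L} → Chain a b L → HeadEnd≥ a L
  Chain-head-end [] = tt
  Chain-head-end (a≤e ∷ _) = a≤e

  TrimmedSuffix : Fin h → List Interval → Set
  TrimmedSuffix x [] = ⊤
  TrimmedSuffix x ((s , e) ∷ rest) = ∃ λ pre → ∃ λ B → hap x ≡ pre ++ (B , e) ∷ rest × B ≤ s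

  hap-TrimmedSuffix : ∀ x → TrimmedSuffix x (hap x)
  hap-TrimmedSuffix x with hap x in hap≡
  ... | [] = tt
  ... | (s , e) ∷ rest = [] , s , hap≡ , ≤-refl

  TrimmedSuffix-head : ∀ {x s e rest} → TrimmedSuffix x ((s , e) ∷ rest) → ∃ λ B → (B , e) ∈ hap x × B ≤ s
  TrimmedSuffix-head (pre , B , hap≡ , B≤s) = B , subst (_ ∈_) (sym hap≡) (∈-++⁺ʳ pre (here refl)) , B≤s

  TrimmedSuffix-tail : ∀ {x s e rest a b} → TrimmedSuffix x ((s , e) ∷ rest) → Chain a b rest →
                       TrimmedSuffix x rest
  TrimmedSuffix-tail _ [] = tt
  TrimmedSuffix-tail {rest = (s′ , e′) ∷ rest′} (pre , B , hap≡ , _) (_ ∷ _) =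
    pre ∷ʳ (B , _) , s′ , trans hap≡ (sym (++-assoc pre [ (B , _) ] ((s′ , e′) ∷ rest′))) , ≤-refl

  -- The refined segments RSx and the pending intervals Lx of haplotype x tile
  -- [1, m], meeting at the frontier; Lx is what Active Splits left of hap x.
  record Tiling (t : ℕ) (x : Fin h) (Lx RSx : List Interval) : Set where
    constructor tiling
    field
      frontier       : ℕ
      refined-chain  : Chain 1 frontier RSx
      pending-chain  : Chain frontier (suc m) Lx
      frontier≤      : frontier ≤ t
      head-end       : HeadEnd≥ t Lx
      pending-suffix : TrimmedSuffix x Lx
      refined-within : All (WithinHap x) RSx

  open Tiling

  Tiling-ends : ∀ {t x Lx RSx b j} → Tiling t x Lx RSx → (b , j) ∈ RSx → b ≤ j × j < t
  Tiling-ends T mem with Chain-∈ (refined-chain T) mem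
  ... | _ , b≤j , j<g = b≤j , ≤-trans j<g (frontier≤ T)

  Tiling-head≤ : ∀ {t x f e rest RSx} → Tiling t x ((f , e) ∷ rest) RSx → f ≤ t
  Tiling-head≤ (tiling _ _ (_ ∷ _) f≤t _ _ _) = f≤t

  Tiling-suc : ∀ {t x Lx RSx} → Tiling t x Lx RSx → HeadEnd≥ (suc t) Lx → Tiling (suc t) x Lx RSx
  Tiling-suc (tiling g refined pending g≤t _ suffix within) head-end′ =
    tiling g refined pending (m≤n⇒m≤1+n g≤t) head-end′ suffix within

  Tiling-cut : ∀ {t x f e rest RSx Lnew} → Tiling t x ((f , e) ∷ rest) RSx →
               Chain (suc t) (suc m) Lnew → TrimmedSuffix x Lnew → Tiling (suc t) x Lnew (RSx ∷ʳ (f , t))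
  Tiling-cut (tiling _ refined (_ ∷ _) f≤t t≤e suffix within) chain suffix′ with TrimmedSuffix-head suffix
  ... | B , B,e∈hap , B≤f =
    tiling _ (Chain-∷ʳ refined f≤t) chain ≤-refl (Chain-head-end chain) suffix′
           (++⁺ within ((_ , B,e∈hap , B≤f , t≤e) ∷ []))

  Tiling-passive : ∀ {t x f rest RSx} → Tiling t x ((f , t) ∷ rest) RSx →
                   Chain (suc t) (suc m) rest × TrimmedSuffix x rest
  Tiling-passive (tiling _ _ (_ ∷ chain) _ _ suffix _) = chain , TrimmedSuffix-tail suffix chain

  Tiling-active : ∀ {t x f e rest RSx} → Tiling t x ((f , e) ∷ rest) RSx → t ≢ e →
                  Chain (suc t) (suc m) ((suc t , e) ∷ rest) × TrimmedSuffix x ((suc t , e) ∷ rest)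
  Tiling-active (tiling _ _ (_ ∷ chain) f≤t t≤e (pre , B , hap≡ , B≤f) _) t≢e =
    ≤∧≢⇒< t≤e t≢e ∷ chain , pre , B , hap≡ , ≤-trans B≤f (m≤n⇒m≤1+n f≤t)

  Tiling-φ : ∀ {k c f e rest RSc p} → Tiling (suc k) c ((f , e) ∷ rest) RSc → f ≤ k →
             φ S (suc k) c ≡ just p → φ S k c ≡ just p
  Tiling-φ {zero} (tiling _ refined (_ ∷ _) _ _ _ _) f≤0 _ = ⊥-elim (<⇒≱ (Chain-≤ refined) f≤0)
  Tiling-φ {suc k} {c} (tiling _ _ (_ ∷ _) _ 1+k<e suffix _) f≤k φc with TrimmedSuffix-head suffix
  ... | B , B,e∈hap , B≤f =
    φ-¬runTop k (HaplotypeIntervals.hapIntervals-¬runTop m S c B,e∈hap (≤-trans B≤f f≤k) 1+k<e) φc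

  -- Besides the segments RS p already holds, p can still cut at most one segment
  -- overlapping [b, j]: the next one from its pending intervals, if it starts by j.
  potential : (L RS : Fin h → List Interval) → Fin h → ℕ → ℕ → ℕ
  potential L RS p b j = countOverlaps (b , j) (RS p) + headStartsBy j (L p)

  RefinedBound : (L RS : Fin h → List Interval) → Fin h → Set
  RefinedBound L RS x = ∀ {b j} → (b , j) ∈ RS x → ∀ {p} → φ S j x ≡ just p → potential L RS p b j ≤ d

  -- No Active Split of x happened in column k. Ends rather than overlaps are
  -- counted: segments cut after column k end after k and leave the count unchanged.
  PendingBound : ℕ → (L RS : Fin h → List Interval) → Fin h → Set
  PendingBound k L RS x = ∀ {f e rest} → L x ≡ (f , e) ∷ rest → f ≤ k →
                          ∀ {p} → φ S k x ≡ just p → countEnds f k (RS p) < d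

  pending-ends<d : ∀ {k L RS c f e rest p} → L c ≡ (f , e) ∷ rest → Tiling (suc k) c (L c) (RS c) →
                   PendingBound k L RS c → φ S (suc k) c ≡ just p → countEnds f k (RS p) < d
  pending-ends<d {k} {L} {RS} {c} {f} {p = p} eqL T pending φc with f ≤? k
  ... | yes f≤k = pending eqL f≤k (Tiling-φ (subst (λ Lc → Tiling (suc k) c Lc (RS c)) eqL T) f≤k φc)
  ... | no f≰k  =
    subst (_< d) (sym (count-none (endsIn? f k) (RS p) λ _ (f≤y , y≤k) → f≰k (≤-trans f≤y y≤k))) 0<d

  Dichotomy : ℕ → ℕ → Set
  Dichotomy C I = C < d ⊎ (C ≤ d × I ≡ 0)

  Dichotomy⇒+≤ : ∀ {C I} → Dichotomy C I → I ≤ 1 → C + I ≤ d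
  Dichotomy⇒+≤ {C} (inj₁ C<d) I≤1 = ≤-trans (+-monoʳ-≤ C I≤1) (subst (_≤ d) (+-comm 1 C) C<d)
  Dichotomy⇒+≤ {C} (inj₂ (C≤d , refl)) _ = subst (_≤ d) (sym (+-identityʳ C)) C≤d

  Dichotomy⇒< : ∀ {C I} → Dichotomy C I → C ≢ d → C < d
  Dichotomy⇒< (inj₁ C<d) _ = C<d
  Dichotomy⇒< (inj₂ (C≤d , _)) C≢d = ≤∧≢⇒< C≤d C≢d

  overlaps≡ends : ∀ {t f p Lp RSp} → Tiling (suc t) p Lp RSp → countOverlaps (f , t) RSp ≡ countEnds f t RSp
  overlaps≡ends {RSp = RSp} T = countOverlaps≡countEnds RSp (λ mem → map₂ ≤-pred (Tiling-ends T mem))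

  -- At most one segment of p ends exactly at t; if one does, p's frontier has moved past t.
  predecessor-dichotomy : ∀ {k f p Lp RSp} → Tiling (suc (suc k)) p Lp RSp → f ≤ suc k → countEnds f k RSp < d →
                          Dichotomy (countOverlaps (f , suc k) RSp) (headStartsBy (suc k) Lp)
  predecessor-dichotomy {k} {f} {RSp = RSp} T f≤t ends<d
    rewrite overlaps≡ends {f = f} T | countEnds-split RSp f≤t
    with countEnds (suc k) (suc k) RSp in ends-at-t | countEnds-Chain-≤1 (suc k) (refined-chain T)
  ... | 0 | _ = inj₁ (subst (_< d) (sym (+-identityʳ _)) ends<d)
  ... | 1 | _ = inj₂ (subst (_≤ d) (+-comm 1 _) ends<d , headStartsBy-Chain (pending-chain T) t<frontier)
    where
    t<frontier : suc k < frontier T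
    t<frontier with count>0⇒∃ (endsIn? (suc k) (suc k)) RSp (subst (0 <_) (sym ends-at-t) z<s)
    ... | _ , mem , t≤y , _ = ≤-trans (s≤s t≤y) (proj₂ (proj₂ (Chain-∈ (refined-chain T) mem)))
  ... | suc (suc _) | s≤s ()

  -- Midway through column k + 1: the rows in done are processed, those in todo are not.
  record ColumnInvariant (k : ℕ) (done todo : List (Fin h)) (L RS : Fin h → List Interval) : Set where
    field
      todo-tiling   : ∀ {x} → x ∈ todo → Tiling (suc k) x (L x) (RS x)
      todo-pending  : ∀ {x} → x ∈ todo → PendingBound k L RS x
      done-tiling   : ∀ {x} → x ∈ done → Tiling (suc (suc k)) x (L x) (RS x)
      done-pending  : ∀ {x} → x ∈ done → PendingBound (suc k) L RS x
      done-closed   : ∀ {x p} → x ∈ done → φ S (suc k) x ≡ just p → p ∈ done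
      refined-bound : ∀ x → RefinedBound L RS x

  module Processing {k done c todo} {L RS : Fin h → List Interval}
                    (split : done ++ c ∷ todo ≡ PA k) (inv : ColumnInvariant k done (c ∷ todo) L RS) where

    open ColumnInvariant inv

    t : ℕ
    t = suc k

    c∉done×c∉todo : c ∉ done × c ∉ todo
    c∉done×c∉todo = Unique-++-∷ done (subst Unique (sym split) (PA-unique k))

    c∉done : c ∉ done
    c∉done = proj₁ c∉done×c∉todo

    c∉todo : c ∉ todo
    c∉todo = proj₂ c∉done×c∉todo

    φc≡last : φ S t c ≡ last done
    φc≡last = trans (cong (predIn c) (sym split)) (predIn-++-∷ c done todo c∉done c∉todo)

    predecessor∈done : ∀ {p} → φ S t c ≡ just p → p ∈ done
    predecessor∈done φc = last-∈ done (trans (sym φc≡last) φc)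

    tiling-c : ∀ {f e rest} → L c ≡ (f , e) ∷ rest → Tiling t c ((f , e) ∷ rest) (RS c)
    tiling-c eqL = subst (λ Lc → Tiling t c Lc (RS c)) eqL (todo-tiling (here refl))

    refined-ends : ∀ {x b j} → (b , j) ∈ RS x → b ≤ j × j ≤ t
    refined-ends {x} mem with ∈-++⁻ done (subst (x ∈_) (sym split) (PA-complete k x))
    ... | inj₁ x∈done = map₂ ≤-pred (Tiling-ends (done-tiling x∈done) mem)
    ... | inj₂ x∈todo = map₂ <⇒≤ (Tiling-ends (todo-tiling x∈todo) mem)

    dichotomy : ∀ {f e rest p} → L c ≡ (f , e) ∷ rest → φ S t c ≡ just p →
                Dichotomy (countOverlaps (f , t) (RS p)) (headStartsBy t (L p))
    dichotomy eqL φc = predecessor-dichotomy (done-tiling (predecessor∈done φc)) (Tiling-head≤ (tiling-c eqL))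
                         (pending-ends<d {L = L} {RS} eqL (todo-tiling (here refl)) (todo-pending (here refl)) φc)

    done-closed-∷ʳ : ∀ {x p} → x ∈ done ∷ʳ c → φ S t x ≡ just p → p ∈ done ∷ʳ c
    done-closed-∷ʳ x∈ φx with ∈-++⁻ done x∈
    ... | inj₁ x∈done     = ∈-++⁺ˡ (done-closed x∈done φx)
    ... | inj₂ (here refl) = ∈-++⁺ˡ (predecessor∈done φx)

    keep : Tiling (suc t) c (L c) (RS c) → PendingBound t L RS c → ColumnInvariant k (done ∷ʳ c) todo L RS
    keep tiling′ pending′ = record
      { todo-tiling   = todo-tiling ∘ there
      ; todo-pending  = todo-pending ∘ there
      ; done-tiling   = λ x∈ → [ done-tiling , (λ { (here refl) → tiling′ }) ]′ (∈-++⁻ done x∈)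
      ; done-pending  = λ x∈ → [ done-pending , (λ { (here refl) → pending′ }) ]′ (∈-++⁻ done x∈)
      ; done-closed   = done-closed-∷ʳ
      ; refined-bound = refined-bound
      }

    extend-invariant : ∀ {f e rest} → L c ≡ (f , e) ∷ rest → t ≢ e →
                       (∀ {p} → last done ≡ just p → countOverlaps (f , t) (RS p) ≢ d) →
                       ColumnInvariant k (done ∷ʳ c) todo L RS
    extend-invariant eqL t≢e no-split = keep (Tiling-suc (todo-tiling (here refl)) head-end′) pending′
      where
      head-end′ : HeadEnd≥ (suc t) (L c)
      head-end′ = subst (HeadEnd≥ (suc t)) (sym eqL) (≤∧≢⇒< (head-end (tiling-c eqL)) t≢e)
      pending′ : PendingBound t L RS c
      pending′ eq′ _ φc with trans (sym eqL) eq′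
      ... | refl = subst (_< d) (overlaps≡ends (done-tiling (predecessor∈done φc)))
                         (Dichotomy⇒< (dichotomy eqL φc) (no-split (trans (sym φc≡last) φc)))

    finished-invariant : L c ≡ [] → ColumnInvariant k (done ∷ʳ c) todo L RS
    finished-invariant eqL = keep (Tiling-suc (todo-tiling (here refl)) (subst (HeadEnd≥ (suc t)) (sym eqL) tt))
                                  (λ eq′ → contradiction (trans (sym eqL) eq′) λ ())

    module Cut {f e rest Lnew} (eqL : L c ≡ (f , e) ∷ rest)
               (Lnew-chain : Chain (suc t) (suc m) Lnew) (Lnew-suffix : TrimmedSuffix c Lnew) where

      L′ RS′ : Fin h → List Interval
      L′  = update L c Lnew
      RS′ = update RS c (RS c ∷ʳ (f , t))

      unchanged-tiling : ∀ {t′ x} → x ≢ c → Tiling t′ x (L x) (RS x) → Tiling t′ x (L′ x) (RS′ x)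
      unchanged-tiling x≢c = subst₂ (Tiling _ _) (sym (update-≢ L c Lnew x≢c)) (sym (update-≢ RS c _ x≢c))

      tiling′ : Tiling (suc t) c (L′ c) (RS′ c)
      tiling′ = subst₂ (Tiling (suc t) c) (sym (update-≡ L c Lnew)) (sym (update-≡ RS c _))
                       (Tiling-cut (tiling-c eqL) Lnew-chain Lnew-suffix)

      -- Abstracting p ≟ᶠ c also evaluates the updates at p.
      countEnds-unchanged : ∀ f′ p → countEnds f′ k (RS′ p) ≡ countEnds f′ k (RS p)
      countEnds-unchanged f′ p with p ≟ᶠ c
      ... | no _     = refl
      ... | yes refl = count-∷ʳ-reject (endsIn? f′ k) (RS c) λ (_ , t≤k) → <-irrefl refl t≤k

      potential-unchanged : ∀ p {b j} → b ≤ j → j ≤ t → potential L′ RS′ p b j ≡ potential L RS p b j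
      potential-unchanged p {b} {j} b≤j j≤t with p ≟ᶠ c
      ... | no _     = refl
      ... | yes refl = begin
        countOverlaps (b , j) (RS c ∷ʳ (f , t)) + headStartsBy j Lnew
          ≡⟨ cong (countOverlaps (b , j) (RS c ∷ʳ (f , t)) +_) (headStartsBy-Chain Lnew-chain (s≤s j≤t)) ⟩
        countOverlaps (b , j) (RS c ∷ʳ (f , t)) + 0
          ≡⟨ +-identityʳ _ ⟩
        countOverlaps (b , j) (RS c ∷ʳ (f , t))
          ≡⟨ countOverlaps-cut (RS c) f e rest b≤j j≤t ⟩
        countOverlaps (b , j) (RS c) + headStartsBy j ((f , e) ∷ rest)
          ≡⟨ cong (λ Lc → countOverlaps (b , j) (RS c) + headStartsBy j Lc) (sym eqL) ⟩
        potential L RS c b j ∎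
        where open ≡-Reasoning

      old-segment-bound : ∀ {x b j p} → (b , j) ∈ RS x → φ S j x ≡ just p → potential L′ RS′ p b j ≤ d
      old-segment-bound mem φx with refined-ends mem
      ... | b≤j , j≤t = subst (_≤ d) (sym (potential-unchanged _ b≤j j≤t)) (refined-bound _ mem φx)

      new-segment-bound : ∀ {p} → φ S t c ≡ just p → potential L′ RS′ p f t ≤ d
      new-segment-bound φc = subst (_≤ d) (sym (potential-unchanged _ (Tiling-head≤ (tiling-c eqL)) ≤-refl))
                                   (Dichotomy⇒+≤ (dichotomy eqL φc) (headStartsBy-≤1 t (L _)))

      refined-bound′ : ∀ x → RefinedBound L′ RS′ x
      refined-bound′ x {b} {j} mem φx with x ≟ᶠ c
      ... | no _     = old-segment-bound mem φx
      ... | yes refl with ∈-++⁻ (RS c) mem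
      ...   | inj₁ mem′ = old-segment-bound mem′ φx
      ...   | inj₂ (here refl) = new-segment-bound φx

      done-pending′ : ∀ {x} → x ∈ done ∷ʳ c → PendingBound t L′ RS′ x
      done-pending′ x∈ {f′} {e′} {rest′} eq′ f′≤t {p} φx with ∈-++⁻ done x∈
      ... | inj₁ x∈done =
        subst (λ R → countEnds f′ t R < d) (sym (update-≢ RS c _ p≢c))
              (done-pending x∈done (trans (sym (update-≢ L c Lnew x≢c)) eq′) f′≤t φx)
        where
        x≢c : _ ≢ c
        x≢c refl = c∉done x∈done
        p≢c : p ≢ c
        p≢c refl = c∉done (done-closed x∈done φx)
      ... | inj₂ (here refl) = contradiction f′≤t (<⇒≱ (≤-reflexive (sym (Chain-head Lnew-chain′))))
        where
        Lnew-chain′ : Chain (suc t) (suc m) ((f′ , e′) ∷ rest′)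
        Lnew-chain′ = subst (Chain (suc t) (suc m)) (trans (sym (update-≡ L c Lnew)) eq′) Lnew-chain

      invariant : ColumnInvariant k (done ∷ʳ c) todo L′ RS′
      invariant = record
        { todo-tiling   = λ x∈ → unchanged-tiling (λ { refl → c∉todo x∈ }) (todo-tiling (there x∈))
        ; todo-pending  = λ x∈ eq′ f′≤k {p} φx →
            subst (_< d) (sym (countEnds-unchanged _ p))
                  (todo-pending (there x∈) (trans (sym (update-≢ L c Lnew λ { refl → c∉todo x∈ })) eq′)
                                f′≤k φx)
        ; done-tiling   = λ x∈ →
            [ (λ x∈done → unchanged-tiling (λ { refl → c∉done x∈done }) (done-tiling x∈done))
            , (λ { (here refl) → tiling′ }) ]′ (∈-++⁻ done x∈)
        ; done-pending  = done-pending′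
        ; done-closed   = done-closed-∷ʳ
        ; refined-bound = refined-bound′
        }

    step-invariant : let st = step d t (L , RS) (last done) c in
                     ColumnInvariant k (done ∷ʳ c) todo (proj₁ st) (proj₂ st)
    step-invariant with step d t (L , RS) (last done) c | step-view d t L RS (last done) c
    ... | _ | passive eqL         = uncurry (Cut.invariant eqL) (Tiling-passive (tiling-c eqL))
    ... | _ | active eqL t≢e      = uncurry (Cut.invariant eqL) (Tiling-active (tiling-c eqL) t≢e)
    ... | _ | extend eqL t≢e no-split = extend-invariant eqL t≢e no-split
    ... | _ | finished eqL        = finished-invariant eqL

  colPass-invariant : ∀ {k} done todo {L RS} prev → done ++ todo ≡ PA k → prev ≡ last done →
                      ColumnInvariant k done todo L RS →
                      let st = colPass d (suc k) (L , RS) prev todo in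
                      ColumnInvariant k (PA k) [] (proj₁ st) (proj₂ st)
  colPass-invariant {k} done [] {L} {RS} _ split _ inv =
    subst (λ done′ → ColumnInvariant k done′ [] L RS) (trans (sym (++-identityʳ done)) split) inv
  colPass-invariant done (c ∷ todo) _ split refl inv =
    colPass-invariant (done ∷ʳ c) todo (just c) (trans (++-assoc done [ c ] todo) split) (sym (last-∷ʳ done c))
                      (Processing.step-invariant split inv)

  next-column : ∀ {k L RS} → ColumnInvariant k (PA k) [] L RS → ColumnInvariant (suc k) [] (PA (suc k)) L RS
  next-column {k} inv = record
    { todo-tiling   = λ {x} _ → done-tiling (PA-complete k x)
    ; todo-pending  = λ {x} _ → done-pending (PA-complete k x)
    ; done-tiling   = λ ()
    ; done-pending  = λ ()
    ; done-closed   = λ ()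
    ; refined-bound = refined-bound
    }
    where open ColumnInvariant inv

  processColumn : State h → ℕ → State h
  processColumn st j = colPass d j st nothing (PAcol S j)

  columns-invariant : ∀ n {k L RS} → k + n ≡ m → ColumnInvariant k [] (PA k) L RS →
                      let st = foldl processColumn (L , RS) (range (suc k) n) in
                      ColumnInvariant m [] (PA m) (proj₁ st) (proj₂ st)
  columns-invariant zero {k} {L} {RS} k+0≡m inv =
    subst (λ k′ → ColumnInvariant k′ [] (PA k′) L RS) (trans (sym (+-identityʳ k)) k+0≡m) inv
  columns-invariant (suc n) {k} k+n≡m inv =
    columns-invariant n (trans (sym (+-suc k n)) k+n≡m)
                      (next-column (colPass-invariant [] (PA k) nothing refl refl inv))

  initial-invariant : ColumnInvariant 0 [] (PA 0) hap (λ _ → [])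
  initial-invariant = record
    { todo-tiling   = λ {x} _ →
        tiling 1 [] (hap-Chain x) ≤-refl (Chain-head-end (hap-Chain x)) (hap-TrimmedSuffix x) []
    ; todo-pending  = λ {x} _ hap≡ f≤0 →
        contradiction f≤0 (<⇒≱ (≤-reflexive (sym (Chain-head (subst (Chain 1 (suc m)) hap≡ (hap-Chain x))))))
    ; done-tiling   = λ ()
    ; done-pending  = λ ()
    ; done-closed   = λ ()
    ; refined-bound = λ _ ()
    }
    where
    hap-Chain : ∀ x → Chain 1 (suc m) (hap x)
    hap-Chain x = HaplotypeIntervals.hapIntervals-Chain m S x

  final-invariant : ColumnInvariant m [] (PA m) (proj₁ (runAlg m d S)) (RSfinal m d S)
  final-invariant =
    subst (λ cols → let st = foldl processColumn (initState m S) cols in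
                    ColumnInvariant m [] (PA m) (proj₁ st) (proj₂ st))
          (sym (columns≡range m)) (columns-invariant m refl initial-invariant)

lemma9 : (h m d : ℕ) → 1 < d → (S : Haplotypes h) → (c : Fin h) → (b j : ℕ)
    → (b , j) ∈ RSfinal m d S c
    → (∃ λ I → I ∈ hapIntervals m S c × Subinterval (b , j) I)
    × ((c' : Fin h) → φ S j c ≡ just c' → countOverlaps (b , j) (RSfinal m d S c') ≤ d)
lemma9 h m d 1<d S c b j mem = within , bounded
  where
  open Columns S using (PA-complete)
  open Decomposition m d (<-trans z<s 1<d) S
  open ColumnInvariant final-invariant

  within : ∃ λ I → I ∈ hapIntervals m S c × Subinterval (b , j) I
  within = All.lookup (Tiling.refined-within (todo-tiling (PA-complete m c))) mem

  bounded : (c' : Fin h) → φ S j c ≡ just c' → countOverlaps (b , j) (RSfinal m d S c') ≤ d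
  bounded c' φc = ≤-trans (m≤m+n _ _) (refined-bound c mem φc)
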